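{- Let $G\in\mathscr{G}_{a,b}$ and let $R=u_1u_2\cdots u_k$ be a path or a cycle (in the latter case $u_1=u_k$) of $G_0$ of length at least $3$ such that $d_{G_0}(u_1)=d_{G_0}(u_k)\in\{3,4\}$ and $d_{G_0}(u_i)=2$ for $2\leq i\leq k-1$. (i) If there is $i\in\{2,\ldots,k-2\}$ such that $d(u_i)\neq d(u_{i+1})$, then $l(R)=3$ and $b=1$; moreover, if $d_{G_0}(u_1)=3$, then $a=6$, $d(u_1)=d_{G_0}(u_1)=3$, and either $d(u_2)=2,\ d(u_3)=4$ or $d(u_2)=4,\ d(u_3)=2$; and if $d_{G_0}(u_1)=4$, then $a=7$, $d(u_1)=d_{G_0}(u_1)=4$, and either $d(u_2)=2,\ d(u_3)=5$ or $d(u_2)=5,\ d(u_3)=2$. (ii) If $d(u_2)=d(u_3)=\cdots=d(u_{k-1})=d$, then $d\in\{2,a-b-1\}$; moreover, if $R$ is a cycle, then $l(R)=3$ and $d(u_2)=d(u_3)=2$.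
   Context: Graphs are finite, simple and connected; $d(v)$ denotes the degree of $v$ in $G$ and $s(v)=\sum_{u\in N_G(v)}d(u)$. A graph $G$ is 2-walk $(a,b)$-parabolic if there exist uniquely a positive integer $a$ and a non-negative integer $b$ such that $a^2-8b>0$ and $s(v)=-d(v)^2+a\,d(v)-b$ for all $v\in V(G)$. A bicyclic graph is a simple connected graph with number of edges equal to number of vertices plus one. $\mathscr{G}_{a,b}$ is the set of 2-walk $(a,b)$-parabolic bicyclic graphs $G$ with minimum degree $\delta(G)=1$. For $G\in\mathscr{G}_{a,b}$, $G_0$ is the graph obtained from $G$ by deleting all pendant (degree-1) vertices, and $d_{G_0}(v)$ is the degree of $v$ in $G_0$. The length $l(R)$ of a path or cycle is its number of edges. -}

module Defs where

open import Data.Nat using (ℕ; zero; suc; _+_; _*_; _∸_; _≤_; _<_; _≤ᵇ_)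
open import Data.Bool using (Bool; true; false; if_then_else_; _∧_)
open import Data.Fin using (Fin)
open import Data.List using (List; map; allFin)
open import Data.Nat.ListAction using (sum)
open import Data.Product using (Σ; ∃; _×_; _,_)
open import Data.Sum using (_⊎_)
open import Relation.Binary.PropositionalEquality using (_≡_; _≢_)

record Graph (n : ℕ) : Set where
  field
    adj   : Fin n → Fin n → Bool
    sym   : ∀ x y → adj x y ≡ adj y x
    irrefl : ∀ x → adj x x ≡ false
open Graph public

module _ {n : ℕ} (G : Graph n) where

  deg : Fin n → ℕ
  deg v = sum (map (λ u → if adj G v u then 1 else 0) (allFin n))

  s : Fin n → ℕ
  s v = sum (map (λ u → if adj G v u then deg u else 0) (allFin n))

  degSum : ℕ
  degSum = sum (map deg (allFin n))

  data Walk : Fin n → Fin n → Set where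
    here : ∀ {x} → Walk x x
    step : ∀ {x y z} → adj G x y ≡ true → Walk y z → Walk x z

  Connected : Set
  Connected = ∀ x y → Walk x y

  -- bicyclic: connected and |E| = |V| + 1  (i.e. 2|E| = 2(|V|+1))
  Bicyclic : Set
  Bicyclic = Connected × degSum ≡ 2 * (n + 1)

  -- s(v) = -d(v)^2 + a d(v) - b, rewritten over ℕ as s + d^2 + b = a d,
  -- together with a > 0 and a^2 - 8b > 0.
  ParabolicEq : ℕ → ℕ → Set
  ParabolicEq a b = (0 < a) × (8 * b < a * a)
                    × (∀ v → s v + deg v * deg v + b ≡ a * deg v)

  Parabolic : ℕ → ℕ → Set
  Parabolic a b = ParabolicEq a b
                  × (∀ a' b' → ParabolicEq a' b' → (a' ≡ a) × (b' ≡ b))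

  MinDegOne : Set
  MinDegOne = (∀ v → 1 ≤ deg v) × ∃ (λ v → deg v ≡ 1)

  InClass : ℕ → ℕ → Set
  InClass a b = Bicyclic × Parabolic a b × MinDegOne

  -- G₀ = G minus its pendant vertices: vertex set {v | d(v) ≥ 2}
  InG0 : Fin n → Set
  InG0 v = 2 ≤ deg v

  degG0 : Fin n → ℕ
  degG0 v = sum (map (λ u → if adj G v u ∧ (2 ≤ᵇ deg u) then 1 else 0) (allFin n))

  -- A vertex sequence u 1, …, u k (indices 1..k of u : ℕ → Fin n) that is a
  -- walk in G₀.
  WalkG0 : ℕ → (ℕ → Fin n) → Set
  WalkG0 k u = (∀ i → 1 ≤ i → i ≤ k → InG0 (u i))
             × (∀ i → 1 ≤ i → i < k → adj G (u i) (u (suc i)) ≡ true)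

  IsPathG0 : ℕ → (ℕ → Fin n) → Set
  IsPathG0 k u = WalkG0 k u
               × (∀ i j → 1 ≤ i → i ≤ k → 1 ≤ j → j ≤ k → i ≢ j → u i ≢ u j)

  IsCycleG0 : ℕ → (ℕ → Fin n) → Set
  IsCycleG0 k u = WalkG0 k u × u 1 ≡ u k
                × (∀ i j → 1 ≤ i → i < k → 1 ≤ j → j < k → i ≢ j → u i ≢ u j)

module Submission where

-- Let P(v) be the number of pendant neighbours of v and s₀(v) the degree sum
-- over its G₀-neighbours.  Then d(v) = d_{G₀}(v) + P(v), s(v) = s₀(v) + P(v)
-- and s₀(v) ≥ 2 d_{G₀}(v); a pendant neighbour u of v has s(u) = d(v), so its
-- equation gives d(v) = a - b - 1 whenever P(v) > 0.  Thus every vertex has a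
-- numerical "profile", and an interior vertex u_i of R satisfies
--   d(u_{i-1}) + d(u_{i+1}) + P(u_i) + d(u_i)² + b = a d(u_i),  d(u_i) = 2 + P(u_i).
-- (i) If two consecutive interior degrees differ, one is 2 and the other is
-- D = a - b - 1; the two equations give the outer degrees b + D - 2 and
-- b (D - 1), and a Diophantine case analysis (the profile of the end u₁
-- excludes (a,b) = (5,1) and (6,2)) shows that both outer vertices are ends
-- of R of degree g, so l(R) = 3.  (ii) The common interior degree is 2 or
-- a - b - 1 by the same dichotomy; on a cycle, degree 2 with l(R) ≥ 4 forces
-- d(u₁) = 2, and degree a - b - 1 contradicts the profile of u₁, whose two
-- R-neighbours then both have that degree.

open import Defs hiding (sym)
open import Data.Nat using (ℕ; zero; suc; _+_; _*_; _∸_; _≤_; _<_; _≤ᵇ_; _≟_; _≤?_; z≤n; s≤s)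
open import Data.Nat.Properties
open import Data.Nat.Tactic.RingSolver using (solve-∀)
open import Data.Nat.ListAction using (sum)
open import Data.Bool using (true; false; if_then_else_; _∧_; not)
open import Data.Bool.Properties using (T-≡)
open import Data.Fin using (Fin; zero; suc; punchIn; punchOut)
open import Data.Fin.Properties using (punchIn-punchOut; ¬∀⟶∃¬)
open import Data.List using (map; allFin; tabulate)
open import Data.List.Properties using (map-tabulate)
open import Data.Vec.Functional using (removeAt)
open import Data.Product using (Σ; ∃; _×_; _,_; proj₁; proj₂)
open import Data.Sum using (_⊎_; inj₁; inj₂)
open import Data.Empty using (⊥; ⊥-elim)
open import Function using (_∘_; id; Equivalence)
open import Relation.Nullary using (¬_; yes; no)
open import Relation.Nullary.Decidable using (from-no)
open import Relation.Binary.PropositionalEquality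
open import Algebra.Properties.CommutativeMonoid.Sum +-0-commutativeMonoid
  using (sum-cong-≗; ∑-distrib-+; sum-remove) renaming (sum to ∑)

sum-allFin : ∀ {n} (f : Fin n → ℕ) → sum (map f (allFin n)) ≡ ∑ f
sum-allFin f = trans (cong sum (map-tabulate id f)) (sum-tabulate f)
  where
  sum-tabulate : ∀ {m} (g : Fin m → ℕ) → sum (tabulate g) ≡ ∑ g
  sum-tabulate {zero}  g = refl
  sum-tabulate {suc m} g = cong (g zero +_) (sum-tabulate (g ∘ suc))

∑-mono-≤ : ∀ {n} {f g : Fin n → ℕ} → (∀ i → f i ≤ g i) → ∑ f ≤ ∑ g
∑-mono-≤ {zero}  f≤g = z≤n
∑-mono-≤ {suc n} f≤g = +-mono-≤ (f≤g zero) (∑-mono-≤ (f≤g ∘ suc))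

∑≡0⇒≡0 : ∀ {n} (f : Fin n → ℕ) → ∑ f ≡ 0 → ∀ i → f i ≡ 0
∑≡0⇒≡0 f ∑f≡0 zero    = m+n≡0⇒m≡0 (f zero) ∑f≡0
∑≡0⇒≡0 f ∑f≡0 (suc i) = ∑≡0⇒≡0 (f ∘ suc) (m+n≡0⇒n≡0 (f zero) ∑f≡0) i

∑-zero : ∀ {n} (f : Fin n → ℕ) → (∀ i → f i ≡ 0) → ∑ f ≡ 0
∑-zero {zero}  f f≡0 = refl
∑-zero {suc n} f f≡0 = cong₂ _+_ (f≡0 zero) (∑-zero (f ∘ suc) (f≡0 ∘ suc))

∑-single-support : ∀ {n} (c w : Fin n → ℕ) (x : Fin n) →
  (∀ i → c i ≡ 0 → w i ≡ 0) → c x ≡ 1 → ∑ c ≡ 1 → ∑ w ≡ w x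
∑-single-support {suc n} c w x supp cx≡1 ∑c≡1 = begin
  ∑ w                         ≡⟨ sum-remove {i = x} w ⟩
  w x + ∑ (removeAt w x)      ≡⟨ cong (w x +_) (∑-zero (removeAt w x) (λ j → supp (punchIn x j) (∑≡0⇒≡0 (removeAt c x) rest≡0 j))) ⟩
  w x + 0                     ≡⟨ +-comm (w x) 0 ⟩
  w x                         ∎
  where
  open ≡-Reasoning
  rest≡0 : ∑ (removeAt c x) ≡ 0
  rest≡0 = suc-injective (begin
    1 + ∑ (removeAt c x)      ≡⟨ cong (_+ ∑ (removeAt c x)) cx≡1 ⟨
    c x + ∑ (removeAt c x)    ≡⟨ sum-remove {i = x} c ⟨
    ∑ c                       ≡⟨ ∑c≡1 ⟩
    1                         ∎)

∑-two-points : ∀ {n} (c w : Fin n → ℕ) {x y : Fin n} →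
  (∀ i → c i + c i ≤ w i) → (∀ i → c i ≡ 0 → w i ≡ 0) →
  x ≢ y → c x ≡ 1 → c y ≡ 1 →
  ∃ λ r → (∑ c ≡ 2 + r) × (w x + w y + (r + r) ≤ ∑ w) × (r ≡ 0 → ∑ w ≡ w x + w y)
∑-two-points {suc zero} c w {zero} {zero} dom supp x≢y = ⊥-elim (x≢y refl)
∑-two-points {suc (suc m)} c w {x} {y} dom supp x≢y cx≡1 cy≡1 =
  ∑ c₂ , count , weight-bound , weight-exact
  where
  open ≡-Reasoning
  j = punchOut x≢y
  c₂ = removeAt (removeAt c x) j
  w₂ = removeAt (removeAt w x) j
  y≡ : punchIn x j ≡ y
  y≡ = punchIn-punchOut x≢y
  split : (f : Fin (suc (suc m)) → ℕ) → ∑ f ≡ f x + (f y + ∑ (removeAt (removeAt f x) j))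
  split f = begin
    ∑ f                                                       ≡⟨ sum-remove {i = x} f ⟩
    f x + ∑ (removeAt f x)                                    ≡⟨ cong (f x +_) (sum-remove {i = j} (removeAt f x)) ⟩
    f x + (f (punchIn x j) + ∑ (removeAt (removeAt f x) j))   ≡⟨ cong (λ v → f x + (f v + ∑ (removeAt (removeAt f x) j))) y≡ ⟩
    f x + (f y + ∑ (removeAt (removeAt f x) j))               ∎
  count : ∑ c ≡ 2 + ∑ c₂
  count = trans (split c) (cong₂ (λ p q → p + (q + ∑ c₂)) cx≡1 cy≡1)
  rest-bound : ∑ c₂ + ∑ c₂ ≤ ∑ w₂
  rest-bound = subst (_≤ ∑ w₂) (∑-distrib-+ c₂ c₂) (∑-mono-≤ (λ i → dom (punchIn x (punchIn j i))))
  weight-bound : w x + w y + (∑ c₂ + ∑ c₂) ≤ ∑ w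
  weight-bound = subst (w x + w y + (∑ c₂ + ∑ c₂) ≤_)
                   (sym (trans (split w) (sym (+-assoc (w x) (w y) (∑ w₂)))))
                   (+-monoʳ-≤ (w x + w y) rest-bound)
  weight-exact : ∑ c₂ ≡ 0 → ∑ w ≡ w x + w y
  weight-exact r≡0 = begin
    ∑ w                     ≡⟨ split w ⟩
    w x + (w y + ∑ w₂)      ≡⟨ cong (λ t → w x + (w y + t)) (∑-zero w₂ (λ i → supp (punchIn x (punchIn j i)) (∑≡0⇒≡0 c₂ r≡0 i))) ⟩
    w x + (w y + 0)         ≡⟨ sym (+-assoc (w x) (w y) 0) ⟩
    w x + w y + 0           ≡⟨ +-identityʳ (w x + w y) ⟩
    w x + w y               ∎

Branching : ℕ → Set
Branching g = g ≡ 3 ⊎ g ≡ 4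

branching≢2 : ∀ {g} → Branching g → g ≢ 2
branching≢2 (inj₁ refl) ()
branching≢2 (inj₂ refl) ()

-- In a 2-walk (a,b)-parabolic graph every vertex carrying a pendant
-- neighbour has degree x with x + b + 1 = a.
LeafDegree : ℕ → ℕ → ℕ → Set
LeafDegree a b x = 1 + b + x ≡ a

Admissible : ℕ → ℕ → ℕ → ℕ → Set
Admissible a b g x = x ≡ g ⊎ LeafDegree a b x

-- Numerical data of a vertex of G₀-degree g and degree x = g + p
-- (p pendant neighbours) whose G₀-neighbours have degree sum at least σ:
-- the parabolic equation s + x² + b = a x with s ≥ σ + p.
Profile : ℕ → ℕ → ℕ → ℕ → ℕ → Set
Profile a b g σ x = Σ ℕ λ p → (x ≡ g + p) × (p ≡ 0 ⊎ LeafDegree a b x)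
                            × (σ + p + x * x + b ≤ a * x)

-- Numerical data of a vertex of G₀-degree 2 and degree x = 2 + q whose two
-- G₀-neighbours have degree sum exactly σ.
Interior : ℕ → ℕ → ℕ → ℕ → Set
Interior a b σ x = Σ ℕ λ q → (x ≡ 2 + q) × (q ≡ 0 ⊎ LeafDegree a b x)
                            × (σ + q + x * x + b ≡ a * x)

profile-admissible : ∀ {a b g σ x} → Profile a b g σ x → Admissible a b g x
profile-admissible (p , x≡g+p , inj₁ refl , _) = inj₁ (trans x≡g+p (+-identityʳ _))
profile-admissible (p , _     , inj₂ leaf , _) = inj₂ leaf

interior-admissible : ∀ {a b σ x} → Interior a b σ x → Admissible a b 2 x
interior-admissible (q , x≡2+q , inj₁ refl , _) = inj₁ (trans x≡2+q (+-identityʳ 2))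
interior-admissible (q , _     , inj₂ leaf , _) = inj₂ leaf

interior-swap : ∀ {a b l r x} → Interior a b (l + r) x → Interior a b (r + l) x
interior-swap {a} {b} {l} {r} {x} = subst (λ σ → Interior a b σ x) (+-comm l r)

interior-sum-determined : ∀ {a b σ σ' x} → Interior a b σ x → Interior a b σ' x → σ ≡ σ'
interior-sum-determined {a} {b} {σ} {σ'} {x} (q , x≡2+q , _ , eq) (q' , x≡2+q' , _ , eq') =
  +-cancelʳ-≡ (q + x * x + b) σ σ' (begin
    σ  + (q + x * x + b)   ≡⟨ reassoc σ q (x * x) b ⟩
    σ  + q + x * x + b     ≡⟨ eq ⟩
    a * x                  ≡⟨ eq' ⟨
    σ' + q' + x * x + b    ≡⟨ cong (λ t → σ' + t + x * x + b) q'≡q ⟩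
    σ' + q + x * x + b     ≡⟨ reassoc σ' q (x * x) b ⟨
    σ' + (q + x * x + b)   ∎)
  where
  open ≡-Reasoning
  q'≡q : q' ≡ q
  q'≡q = +-cancelˡ-≡ 2 q' q (trans (sym x≡2+q') x≡2+q)
  reassoc : ∀ s t u v → s + (t + u + v) ≡ s + t + u + v
  reassoc = solve-∀

no-branch-5-1 : ∀ {g x} → Branching g → Profile 5 1 g (g + g) x → ⊥
no-branch-5-1 (inj₁ refl) (zero  , refl , _         , bound) = from-no (16 ≤? 15) bound
no-branch-5-1 (inj₁ refl) (suc p , refl , inj₂ ()   , _)
no-branch-5-1 (inj₂ refl) (zero  , refl , _         , bound) = from-no (25 ≤? 20) bound
no-branch-5-1 (inj₂ refl) (suc p , refl , inj₂ ()   , _)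

no-branch-6-2 : ∀ {x} → Profile 6 2 4 (4 + 4) x → ⊥
no-branch-6-2 (zero  , refl , _       , bound) = from-no (26 ≤? 24) bound
no-branch-6-2 (suc p , refl , inj₂ () , _)

data Factorisation : ℕ → ℕ → ℕ → Set where
  1·2 : Factorisation 2 1 0
  1·3 : Factorisation 3 1 1
  1·4 : Factorisation 4 1 2
  2·2 : Factorisation 4 2 0

factorise : ∀ {t} b p → 2 ≤ t → t ≤ 4 → b * (2 + p) ≡ t → Factorisation t b p
factorise 0 p () _ refl
factorise 1 0 _ _ refl = 1·2
factorise 1 1 _ _ refl = 1·3
factorise 1 2 _ _ refl = 1·4
factorise 1 (suc (suc (suc p))) _ (s≤s (s≤s (s≤s (s≤s ())))) refl
factorise 2 0 _ _ refl = 2·2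
factorise (suc (suc b)) (suc p) _ t≤4 refl =
  ⊥-elim (from-no (6 ≤? 4) (≤-trans (*-mono-≤ {2} {2 + b} {3} (s≤s (s≤s z≤n)) (m≤m+n 3 p)) t≤4))
factorise (suc (suc (suc b))) 0 _ t≤4 refl =
  ⊥-elim (from-no (6 ≤? 4) (≤-trans (*-mono-≤ {3} {3 + b} {2} (s≤s (s≤s (s≤s z≤n))) ≤-refl) t≤4))

far-not-leaf : ∀ b p → b * (2 + p) ≢ 3 + p
far-not-leaf 0 p ()
far-not-leaf 1 p eq = m+1+n≢m (1 * (2 + p)) (trans (excess p) (sym eq))
  where excess : ∀ p → 1 * (2 + p) + 1 ≡ 3 + p
        excess = solve-∀
far-not-leaf (suc (suc c)) p eq = m+1+n≢m (3 + p) (trans (sym (excess c p)) eq)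
  where excess : ∀ c p → (2 + c) * (2 + p) ≡ 3 + p + suc (p + c * (2 + p))
        excess = solve-∀

-- The G₀-degree h of a vertex of R: 2 inside, g at an end.
Corner : ℕ → ℕ → Set
Corner g h = h ≡ 2 ⊎ h ≡ g

end-of-R : ∀ {a b g h y} → Corner g h → Admissible a b h y → y ≢ 2 → ¬ LeafDegree a b y →
           (h ≡ g) × (y ≡ g)
end-of-R (inj₁ refl) (inj₁ y≡2)  y≢2 _     = ⊥-elim (y≢2 y≡2)
end-of-R _           (inj₂ leaf) _   ¬leaf = ⊥-elim (¬leaf leaf)
end-of-R (inj₂ refl) (inj₁ y≡g)  _   _     = refl , y≡g

data Jump : ℕ → ℕ → ℕ → ℕ → Set where
  jump₃ : Jump 3 6 1 4
  jump₄ : Jump 4 7 1 5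

-- Around an ascent y, 2, D = 3 + p, z of consecutive degrees along R, with
-- a = D + b + 1, the outer degrees are y = b + 1 + p and z = b (2 + p).
-- Since z ∈ {2, D, g}, z = b (2 + p) leaves the factorisations of 2 and g;
-- the profile of the end u₁ rules out (a, b) = (5, 1) and (6, 2), and what
-- remains forces both outer vertices to be ends of R of degree g.
ascent-values : ∀ {g b p x₁ gy gz} → Branching g → Profile (1 + b + (3 + p)) b g (g + g) x₁ →
  Corner g gy → Corner g gz →
  Admissible (1 + b + (3 + p)) b gy (b + 1 + p) → Admissible (1 + b + (3 + p)) b gz (b * (2 + p)) →
  Jump g (1 + b + (3 + p)) b (3 + p) × (gy ≡ g) × (gz ≡ g) × (b + 1 + p ≡ g) × (b * (2 + p) ≡ g)
ascent-values {b = b} {p} _ _ _ _ _ (inj₂ leaf) =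
  ⊥-elim (far-not-leaf b p (+-cancelˡ-≡ (1 + b) _ _ leaf))
ascent-values {b = b} {p} branching u₁ _ (inj₁ refl) _ (inj₁ z≡2)
  with factorise b p ≤-refl (s≤s (s≤s z≤n)) z≡2
... | 1·2 = ⊥-elim (no-branch-5-1 branching u₁)
ascent-values {b = b} {p} (inj₁ refl) u₁ cy (inj₂ refl) adm-y (inj₁ z≡3)
  with factorise b p (s≤s (s≤s z≤n)) (s≤s (s≤s (s≤s z≤n))) z≡3
... | 1·3 = jump₃ , proj₁ (end-of-R {b = 1} cy adm-y (λ ()) (λ ())) , refl , refl , refl
ascent-values {b = b} {p} (inj₂ refl) u₁ cy (inj₂ refl) adm-y (inj₁ z≡4)
  with factorise b p (s≤s (s≤s z≤n)) ≤-refl z≡4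
... | 1·4 = jump₄ , proj₁ (end-of-R {b = 1} cy adm-y (λ ()) (λ ())) , refl , refl , refl
... | 2·2 with proj₂ (end-of-R {b = 2} cy adm-y (λ ()) (λ _ → no-branch-6-2 u₁))
...   | ()

near-degree : ∀ y b p → y + (3 + p) + 0 + 2 * 2 + b ≡ (1 + b + (3 + p)) * 2 → y ≡ b + 1 + p
near-degree y b p eq = +-cancelʳ-≡ (7 + p + b) y (b + 1 + p) (trans (lhs y b p) (trans eq (rhs b p)))
  where lhs : ∀ y b p → y + (7 + p + b) ≡ y + (3 + p) + 0 + 2 * 2 + b
        lhs = solve-∀
        rhs : ∀ b p → (1 + b + (3 + p)) * 2 ≡ b + 1 + p + (7 + p + b)
        rhs = solve-∀

far-degree : ∀ z b p → 2 + z + suc p + (3 + p) * (3 + p) + b ≡ (1 + b + (3 + p)) * (3 + p) →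
             z ≡ b * (2 + p)
far-degree z b p eq = +-cancelʳ-≡ (3 + p + (3 + p) * (3 + p) + b) z (b * (2 + p))
                        (trans (lhs z b p) (trans eq (rhs b p)))
  where lhs : ∀ z b p → z + (3 + p + (3 + p) * (3 + p) + b) ≡ 2 + z + suc p + (3 + p) * (3 + p) + b
        lhs = solve-∀
        rhs : ∀ b p → (1 + b + (3 + p)) * (3 + p) ≡ b * (2 + p) + (3 + p + (3 + p) * (3 + p) + b)
        rhs = solve-∀

ascent : ∀ {g a b x₁ gy gz y z D} → Branching g → Profile a b g (g + g) x₁ →
  Corner g gy → Corner g gz → Interior a b (y + D) 2 → Interior a b (2 + z) D → D ≢ 2 →
  Admissible a b gy y → Admissible a b gz z →
  Jump g a b D × (gy ≡ g) × (gz ≡ g) × (y ≡ g) × (z ≡ g)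
ascent _ _ _ _ (suc _ , () , _) _ _ _ _
ascent _ _ _ _ _ (zero , refl , _) D≢2 _ _ = ⊥-elim (D≢2 refl)
ascent _ _ _ _ _ (suc p , refl , inj₁ () , _) _ _ _
ascent {b = b} {y = y} {z} branching u₁ cy cz (zero , refl , _ , eq₂) (suc p , refl , inj₂ refl , eqD) _ adm-y adm-z
  with near-degree y b p eq₂ | far-degree z b p eqD
... | refl | refl = ascent-values branching u₁ cy cz adm-y adm-z

jump : ∀ {g a b x₁ gy gz y z x x'} → Branching g → Profile a b g (g + g) x₁ →
  Corner g gy → Corner g gz → Interior a b (y + x') x → Interior a b (x + z) x' → x ≢ x' →
  Admissible a b gy y → Admissible a b gz z →
  Σ ℕ λ D → Jump g a b D × ((x ≡ 2 × x' ≡ D) ⊎ (x ≡ D × x' ≡ 2)) × (gy ≡ g) × (gz ≡ g) × (y ≡ g)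
jump {b = b} {y = y} {z} {x} {x'} branching u₁ cy cz int int' x≢x' adm-y adm-z
  with interior-admissible int | interior-admissible int'
... | inj₁ refl | _ =
  let (J , gy≡g , gz≡g , y≡g , _) = ascent branching u₁ cy cz int int' (x≢x' ∘ sym) adm-y adm-z
  in _ , J , inj₁ (refl , refl) , gy≡g , gz≡g , y≡g
... | inj₂ _ | inj₁ refl =
  let (J , gz≡g , gy≡g , _ , y≡g) =
        ascent branching u₁ cz cy (interior-swap {l = x} {z} int') (interior-swap {l = y} {x'} int) x≢x' adm-z adm-y
  in _ , J , inj₂ (refl , refl) , gy≡g , gz≡g , y≡g
... | inj₂ leaf | inj₂ leaf' = ⊥-elim (x≢x' (+-cancelˡ-≡ (1 + b) _ _ (trans leaf (sym leaf'))))

jump-conclusion : ∀ {g a b D y x x'} → Jump g a b D → ((x ≡ 2 × x' ≡ D) ⊎ (x ≡ D × x' ≡ 2)) → y ≡ g →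
  (b ≡ 1)
  × (g ≡ 3 → (a ≡ 6) × (y ≡ 3) × ((x ≡ 2 × x' ≡ 4) ⊎ (x ≡ 4 × x' ≡ 2)))
  × (g ≡ 4 → (a ≡ 7) × (y ≡ 4) × ((x ≡ 2 × x' ≡ 5) ⊎ (x ≡ 5 × x' ≡ 2)))
jump-conclusion jump₃ middle y≡g = refl , (λ _ → refl , y≡g , middle) , λ ()
jump-conclusion jump₄ middle y≡g = refl , (λ ()) , λ _ → refl , y≡g , middle

end-degree : ∀ {a b g σ x} → Branching g → Profile a b g σ x → x ≢ 2
end-degree (inj₁ refl) (_ , refl , _) ()
end-degree (inj₂ refl) (_ , refl , _) ()

hub-degree : ∀ x₁ b t → x₁ + (3 + t) + suc t + (3 + t) * (3 + t) + b ≡ (1 + b + (3 + t)) * (3 + t) →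
             x₁ + suc t ≡ b * (2 + t)
hub-degree x₁ b t eq = +-cancelʳ-≡ (3 + t + (3 + t) * (3 + t) + b) (x₁ + suc t) (b * (2 + t))
                         (trans (lhs x₁ b t) (trans eq (rhs b t)))
  where lhs : ∀ x b t → x + suc t + (3 + t + (3 + t) * (3 + t) + b) ≡ x + (3 + t) + suc t + (3 + t) * (3 + t) + b
        lhs = solve-∀
        rhs : ∀ b t → (1 + b + (3 + t)) * (3 + t) ≡ b * (2 + t) + (3 + t + (3 + t) * (3 + t) + b)
        rhs = solve-∀

-- With b = 2, an end of degree X = d would need s ≥ 2X + 2r + p but
-- s = 3X - 2, i.e. r ≤ 0.
hub-b=2 : ∀ {X r p} → X ≡ 2 + suc r + p →
          X + X + (suc r + suc r) + p + X * X + 2 ≤ (1 + 2 + X) * X → ⊥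
hub-b=2 {X} {r} {p} refl bound = m+1+n≰m ((1 + 2 + X) * X) (subst (_≤ (1 + 2 + X) * X) (excess r p) bound)
  where excess : ∀ r p → let Y = 2 + suc r + p in
                 Y + Y + (suc r + suc r) + p + Y * Y + 2 ≡ (1 + 2 + Y) * Y + suc r
        excess = solve-∀

-- An end u₁ of G₀-degree 2 + r on a cycle R whose interior vertices all
-- carry pendants: the equation at u₂ gives x₁ + 1 + t = b (2 + t), which
-- contradicts the profile of u₁ for every b.
hub : ∀ b t r {x₁} → 1 ≤ r → r ≤ 2 → x₁ + suc t ≡ b * (2 + t) →
      Profile (1 + b + (3 + t)) b (2 + r) ((3 + t) + (3 + t) + (r + r)) x₁ → ⊥
hub 0 t r {x₁} _ _ E _ = m+1+n≢0 x₁ E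
hub 1 t (suc r) _ _ E (p , refl , _) = m+1+n≢m (1 * (2 + t)) (trans (excess r p t) E)
  where excess : ∀ r p t → 1 * (2 + t) + suc (suc (r + p)) ≡ 2 + suc r + p + suc t
        excess = solve-∀
hub 2 t (suc r) {x₁} _ _ E (p , x₁≡ , _ , bound) =
  hub-b=2 x₁≡ (subst (λ d → d + d + (suc r + suc r) + p + x₁ * x₁ + 2 ≤ (1 + 2 + d) * x₁) (sym x₁≡d) bound)
  where x₁≡d : x₁ ≡ 3 + t
        x₁≡d = +-cancelʳ-≡ (suc t) x₁ (3 + t) (trans E (double t))
          where double : ∀ t → 2 * (2 + t) ≡ 3 + t + suc t
                double = solve-∀
hub (suc (suc (suc c))) t r {x₁} _ r≤2 E (p , refl , inj₁ refl , _) =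
  m+1+n≰m (4 + suc t) (subst (_≤ 4 + suc t) (trans E (excess c t)) small)
  where small : 2 + r + 0 + suc t ≤ 4 + suc t
        small = +-monoˡ-≤ (suc t) (+-monoˡ-≤ 0 (+-monoʳ-≤ 2 r≤2))
        excess : ∀ c t → (3 + c) * (2 + t) ≡ 4 + suc t + suc (t + t + c * (2 + t))
        excess = solve-∀
hub (suc (suc (suc c))) t r {x₁} _ _ E (p , _ , inj₂ leaf , _) =
  m+1+n≢m (3 + t + suc t) (trans (sym (excess c t)) (trans (sym E) (cong (_+ suc t) x₁≡d)))
  where x₁≡d : x₁ ≡ 3 + t
        x₁≡d = +-cancelˡ-≡ (4 + c) x₁ (3 + t) leaf
        excess : ∀ c t → (3 + c) * (2 + t) ≡ 3 + t + suc t + suc (suc (t + c * (2 + t)))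
        excess = solve-∀

no-pendant-cycle : ∀ {a b r d x₁} → Branching (2 + r) → Interior a b (x₁ + d) d → d ≢ 2 →
                   Profile a b (2 + r) (d + d + (r + r)) x₁ → ⊥
no-pendant-cycle _ (zero , refl , _) d≢2 _ = d≢2 refl
no-pendant-cycle _ (suc t , refl , inj₁ () , _) _ _
no-pendant-cycle {b = b} {r} {x₁ = x₁} branching (suc t , refl , inj₂ refl , eq) _ u₁ =
  hub b t r (proj₁ (excess-bounds branching)) (proj₂ (excess-bounds branching)) (hub-degree x₁ b t eq) u₁
  where
  excess-bounds : Branching (2 + r) → 1 ≤ r × r ≤ 2
  excess-bounds (inj₁ refl) = s≤s z≤n , s≤s z≤n
  excess-bounds (inj₂ refl) = s≤s z≤n , s≤s (s≤s z≤n)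

≤ᵇ-true⇒≤ : ∀ {m n} → (m ≤ᵇ n) ≡ true → m ≤ n
≤ᵇ-true⇒≤ {m} {n} eq = ≤ᵇ⇒≤ m n (Equivalence.from T-≡ eq)

≤⇒≤ᵇ-true : ∀ {m n} → m ≤ n → (m ≤ᵇ n) ≡ true
≤⇒≤ᵇ-true le = Equivalence.to T-≡ (≤⇒≤ᵇ le)

unit-degree : ∀ {d} → 1 ≤ d → (2 ≤ᵇ d) ≡ false → d ≡ 1
unit-degree {suc zero}    _ _  = refl
unit-degree {suc (suc d)} _ ()

module Neighbourhood {n} (G : Graph n) where

  nbr nbrDeg core coreDeg leaf : Fin n → Fin n → ℕ
  nbr     v u = if adj G v u then 1 else 0
  nbrDeg  v u = if adj G v u then deg G u else 0
  core    v u = if adj G v u ∧ (2 ≤ᵇ deg G u) then 1 else 0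
  coreDeg v u = if adj G v u ∧ (2 ≤ᵇ deg G u) then deg G u else 0
  leaf    v u = if adj G v u ∧ not (2 ≤ᵇ deg G u) then 1 else 0

  pendants s₀ : Fin n → ℕ
  pendants v = ∑ (leaf v)
  s₀       v = ∑ (coreDeg v)

  deg-split : ∀ v → deg G v ≡ degG0 G v + pendants v
  deg-split v = begin
    deg G v                          ≡⟨ sum-allFin (nbr v) ⟩
    ∑ (nbr v)                        ≡⟨ sum-cong-≗ split ⟩
    ∑ (λ u → core v u + leaf v u)    ≡⟨ ∑-distrib-+ (core v) (leaf v) ⟩
    ∑ (core v) + pendants v          ≡⟨ cong (_+ pendants v) (sum-allFin (core v)) ⟨
    degG0 G v + pendants v           ∎
    where
    open ≡-Reasoning
    split : ∀ u → nbr v u ≡ core v u + leaf v u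
    split u with adj G v u | 2 ≤ᵇ deg G u
    ... | false | _     = refl
    ... | true  | true  = refl
    ... | true  | false = refl

  s-split : (∀ u → 1 ≤ deg G u) → ∀ v → s G v ≡ s₀ v + pendants v
  s-split min-deg v = begin
    s G v                               ≡⟨ sum-allFin (nbrDeg v) ⟩
    ∑ (nbrDeg v)                        ≡⟨ sum-cong-≗ split ⟩
    ∑ (λ u → coreDeg v u + leaf v u)    ≡⟨ ∑-distrib-+ (coreDeg v) (leaf v) ⟩
    s₀ v + pendants v                   ∎
    where
    open ≡-Reasoning
    split : ∀ u → nbrDeg v u ≡ coreDeg v u + leaf v u
    split u with adj G v u | 2 ≤ᵇ deg G u in le
    ... | false | _     = refl
    ... | true  | true  = sym (+-identityʳ (deg G u))
    ... | true  | false = unit-degree (min-deg u) le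

  -- Every G₀-neighbour has degree at least 2.
  core-dominated : ∀ v u → core v u + core v u ≤ coreDeg v u
  core-dominated v u with adj G v u | 2 ≤ᵇ deg G u in le
  ... | false | _     = z≤n
  ... | true  | true  = ≤ᵇ-true⇒≤ le
  ... | true  | false = z≤n

  core-support : ∀ v u → core v u ≡ 0 → coreDeg v u ≡ 0
  core-support v u with adj G v u | 2 ≤ᵇ deg G u
  ... | false | _     = λ _ → refl
  ... | true  | true  = λ ()
  ... | true  | false = λ _ → refl

  s₀-bound : ∀ v → degG0 G v + degG0 G v ≤ s₀ v
  s₀-bound v = subst (_≤ s₀ v) (trans (∑-distrib-+ (core v) (core v)) (cong₂ _+_ (sym count) (sym count)))
                 (∑-mono-≤ (core-dominated v))
    where count = sum-allFin (core v)

  core-at : ∀ {v x} → adj G v x ≡ true → 2 ≤ deg G x → core v x ≡ 1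
  core-at {v} {x} vx dx rewrite vx | ≤⇒≤ᵇ-true dx = refl

  coreDeg-at : ∀ {v x} → adj G v x ≡ true → 2 ≤ deg G x → coreDeg v x ≡ deg G x
  coreDeg-at {v} {x} vx dx rewrite vx | ≤⇒≤ᵇ-true dx = refl

  two-core-neighbours : ∀ {v x y} → x ≢ y → adj G v x ≡ true → adj G v y ≡ true →
    2 ≤ deg G x → 2 ≤ deg G y →
    ∃ λ r → (degG0 G v ≡ 2 + r) × (deg G x + deg G y + (r + r) ≤ s₀ v)
          × (r ≡ 0 → s₀ v ≡ deg G x + deg G y)
  two-core-neighbours {v} {x} {y} x≢y vx vy dx dy
    with ∑-two-points (core v) (coreDeg v) (core-dominated v) (core-support v) x≢y (core-at vx dx) (core-at vy dy)
  ... | r , count , bound , exact =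
    r , trans (sum-allFin (core v)) count
      , subst (λ t → t + (r + r) ≤ s₀ v) (cong₂ _+_ (coreDeg-at vx dx) (coreDeg-at vy dy)) bound
      , λ r≡0 → trans (exact r≡0) (cong₂ _+_ (coreDeg-at vx dx) (coreDeg-at vy dy))

  s-of-leaf : ∀ {u v} → adj G u v ≡ true → deg G u ≡ 1 → s G u ≡ deg G v
  s-of-leaf {u} {v} uv du = begin
    s G u          ≡⟨ sum-allFin (nbrDeg u) ⟩
    ∑ (nbrDeg u)   ≡⟨ ∑-single-support (nbr u) (nbrDeg u) v support nbr-v (trans (sym (sum-allFin (nbr u))) du) ⟩
    nbrDeg u v     ≡⟨ cong (λ e → if e then deg G v else 0) uv ⟩
    deg G v        ∎
    where
    open ≡-Reasoning
    support : ∀ w → nbr u w ≡ 0 → nbrDeg u w ≡ 0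
    support w with adj G u w
    ... | false = λ _ → refl
    ... | true  = λ ()
    nbr-v : nbr u v ≡ 1
    nbr-v rewrite uv = refl

  pendant-neighbour : (∀ u → 1 ≤ deg G u) → ∀ v → pendants v ≢ 0 →
                      ∃ λ u → (adj G u v ≡ true) × (deg G u ≡ 1)
  pendant-neighbour min-deg v p≢0
    with ¬∀⟶∃¬ n (λ u → leaf v u ≡ 0) (λ u → leaf v u ≟ 0) (λ all0 → p≢0 (∑-zero (leaf v) all0))
  ... | u , leaf≢0 with adj G v u in vu | 2 ≤ᵇ deg G u in le
  ...   | false | _     = ⊥-elim (leaf≢0 refl)
  ...   | true  | true  = ⊥-elim (leaf≢0 refl)
  ...   | true  | false = u , trans (Graph.sym G u v) vu , unit-degree (min-deg u) le

module Parabolic {n} (G : Graph n) (a b : ℕ) (min-deg : ∀ u → 1 ≤ deg G u)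
                 (parabolic : ∀ v → s G v + deg G v * deg G v + b ≡ a * deg G v) where
  open Neighbourhood G

  -- A vertex with a pendant neighbour u has degree a - b - 1, by the
  -- equation at u (where d(u) = 1 and s(u) = d(v)).
  pendant-degree : ∀ v → pendants v ≢ 0 → LeafDegree a b (deg G v)
  pendant-degree v p≢0 with pendant-neighbour min-deg v p≢0
  ... | u , uv , du = begin
    1 + b + deg G v                  ≡⟨ reorder b (deg G v) ⟩
    deg G v + 1 * 1 + b              ≡⟨ cong₂ (λ t d → t + d * d + b) (sym (s-of-leaf uv du)) (sym du) ⟩
    s G u + deg G u * deg G u + b    ≡⟨ parabolic u ⟩
    a * deg G u                      ≡⟨ cong (a *_) du ⟩
    a * 1                            ≡⟨ *-identityʳ a ⟩
    a                                ∎
    where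
    open ≡-Reasoning
    reorder : ∀ b d → 1 + b + d ≡ d + 1 * 1 + b
    reorder = solve-∀

  pendant-alternative : ∀ v → pendants v ≡ 0 ⊎ LeafDegree a b (deg G v)
  pendant-alternative v with pendants v ≟ 0
  ... | yes p≡0 = inj₁ p≡0
  ... | no  p≢0 = inj₂ (pendant-degree v p≢0)

  vertex-profile : ∀ v {σ} → σ ≤ s₀ v → Profile a b (degG0 G v) σ (deg G v)
  vertex-profile v {σ} σ≤s₀ = pendants v , deg-split v , pendant-alternative v , bound
    where
    d = deg G v
    p = pendants v
    bound : σ + p + d * d + b ≤ a * d
    bound = subst (σ + p + d * d + b ≤_) (trans (cong (λ t → t + d * d + b) (sym (s-split min-deg v))) (parabolic v))
              (+-monoˡ-≤ b (+-monoˡ-≤ (d * d) (+-monoˡ-≤ p σ≤s₀)))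

  interior-vertex : ∀ {v x y} → degG0 G v ≡ 2 → x ≢ y → adj G v x ≡ true → adj G v y ≡ true →
                    2 ≤ deg G x → 2 ≤ deg G y → Interior a b (deg G x + deg G y) (deg G v)
  interior-vertex {v} {x} {y} d₀≡2 x≢y vx vy dx dy with two-core-neighbours x≢y vx vy dx dy
  ... | r , d₀≡2+r , _ , exact =
    p , trans (deg-split v) (cong (_+ p) d₀≡2) , pendant-alternative v , equation
    where
    d = deg G v
    p = pendants v
    equation : deg G x + deg G y + p + d * d + b ≡ a * d
    equation = trans (cong (λ t → t + p + d * d + b)
                       (sym (exact (+-cancelˡ-≡ 2 r 0 (trans (sym d₀≡2+r) d₀≡2)))))
               (trans (cong (λ t → t + d * d + b) (sym (s-split min-deg v))) (parabolic v))

≤-pred-∸ : ∀ {i K} → i ≤ K ∸ 1 → 1 ≤ K → suc i ≤ K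
≤-pred-∸ {K = suc K} i≤K _ = s≤s i≤K

walk-of : ∀ {n} (G : Graph n) {k u} → IsPathG0 G k u ⊎ IsCycleG0 G k u → WalkG0 G k u
walk-of G (inj₁ path)  = proj₁ path
walk-of G (inj₂ cycle) = proj₁ cycle

Separated : ∀ {n} → ℕ → (ℕ → Fin n) → Set
Separated K u = ∀ m → 1 ≤ m → suc m ≤ K → u m ≢ u (suc (suc m))

path-separated : ∀ {n} (G : Graph n) {K u} → IsPathG0 G (suc K) u → Separated K u
path-separated G (_ , distinct) m 1≤m m<K =
  distinct m (2 + m) 1≤m (≤-trans (n≤1+n m) (m≤n⇒m≤1+n m<K)) (s≤s z≤n) (s≤s m<K) (m≢1+n+m m)

cycle-distinct : ∀ {n} (G : Graph n) {K u} → IsCycleG0 G (suc K) u →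
  ∀ i j → 1 ≤ i → i ≤ K → 1 ≤ j → j ≤ K → i ≢ j → u i ≢ u j
cycle-distinct G (_ , _ , distinct) i j 1≤i i≤K 1≤j j≤K = distinct i j 1≤i (s≤s i≤K) 1≤j (s≤s j≤K)

-- On a cycle of length K ≥ 3 the neighbours of u_K are u_{K-1} and u_{K+1} = u₁.
cycle-separated : ∀ {n} (G : Graph n) {K u} → 3 ≤ K → IsCycleG0 G (suc K) u → Separated K u
cycle-separated G {K} {u} 3≤K cycle@(_ , closed , _) m 1≤m m<K with suc (suc m) ≤? K
... | yes m+2≤K = cycle-distinct G cycle m (2 + m) 1≤m (≤-trans (n≤1+n m) m<K) (s≤s z≤n) m+2≤K (m≢1+n+m m)
... | no  m+2≰K = λ um≡um+2 →
  cycle-distinct G cycle m 1 1≤m (≤-trans (n≤1+n m) m<K) ≤-refl (≤-trans (s≤s z≤n) m<K) m≢1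
    (trans um≡um+2 (trans (cong u m+2≡K+1) (sym closed)))
  where
  m+2≡K+1 : 2 + m ≡ suc K
  m+2≡K+1 = ≤-antisym (s≤s m<K) (≰⇒> m+2≰K)
  m≢1 : m ≢ 1
  m≢1 refl = <⇒≢ 3≤K (suc-injective m+2≡K+1)

separated-of : ∀ {n} (G : Graph n) {K u} → 3 ≤ K → IsPathG0 G (suc K) u ⊎ IsCycleG0 G (suc K) u →
               Separated K u
separated-of G _   (inj₁ path)  = path-separated G path
separated-of G 3≤K (inj₂ cycle) = cycle-separated G 3≤K cycle

-- The setting of the theorem: R = u₁ ⋯ u_{K+1} is a path or a cycle of G₀
-- of length K ≥ 3, whose ends have the same G₀-degree g ∈ {3, 4} and whose
-- interior vertices have G₀-degree 2.
module AlongR {n} (G : Graph n) (a b : ℕ) (min-deg : ∀ v → 1 ≤ deg G v)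
           (parabolic : ∀ v → s G v + deg G v * deg G v + b ≡ a * deg G v)
           (K : ℕ) (u : ℕ → Fin n) (R : IsPathG0 G (suc K) u ⊎ IsCycleG0 G (suc K) u)
           (3≤K : 3 ≤ K) (ends : degG0 G (u 1) ≡ degG0 G (u (suc K)))
           (branching : Branching (degG0 G (u 1)))
           (inner : ∀ i → 2 ≤ i → i ≤ K → degG0 G (u i) ≡ 2) where

  open Neighbourhood G
  open Parabolic G a b min-deg parabolic

  g : ℕ
  g = degG0 G (u 1)

  walk : WalkG0 G (suc K) u
  walk = walk-of G R

  in-G₀ : ∀ i → 1 ≤ i → i ≤ suc K → 2 ≤ deg G (u i)
  in-G₀ = proj₁ walk

  forward : ∀ i → 1 ≤ i → i ≤ K → adj G (u i) (u (suc i)) ≡ true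
  forward i 1≤i i≤K = proj₂ walk i 1≤i (s≤s i≤K)

  backward : ∀ i → 1 ≤ i → i ≤ K → adj G (u (suc i)) (u i) ≡ true
  backward i 1≤i i≤K = trans (Graph.sym G _ _) (forward i 1≤i i≤K)

  separated : Separated K u
  separated = separated-of G 3≤K R

  1≤K : 1 ≤ K
  1≤K = ≤-trans (s≤s z≤n) 3≤K

  2≤K : 2 ≤ K
  2≤K = ≤-trans (n≤1+n 2) 3≤K

  interior-of-R : ∀ m → 1 ≤ m → suc m ≤ K →
                  Interior a b (deg G (u m) + deg G (u (2 + m))) (deg G (u (suc m)))
  interior-of-R m 1≤m m<K =
    interior-vertex (inner (suc m) (s≤s 1≤m) m<K) (separated m 1≤m m<K)
      (backward m 1≤m (≤-trans (n≤1+n m) m<K)) (forward (suc m) (s≤s z≤n) m<K)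
      (in-G₀ m 1≤m (≤-trans (n≤1+n m) (m≤n⇒m≤1+n m<K))) (in-G₀ (2 + m) (s≤s z≤n) (s≤s m<K))

  profile : ∀ v → Profile a b (degG0 G v) (degG0 G v + degG0 G v) (deg G v)
  profile v = vertex-profile v (s₀-bound v)

  admissible : ∀ j → Admissible a b (degG0 G (u j)) (deg G (u j))
  admissible j = profile-admissible (profile (u j))

  vertex-kind : ∀ j → 1 ≤ j → j ≤ suc K →
                degG0 G (u j) ≡ 2 ⊎ ((j ≡ 1 ⊎ j ≡ suc K) × degG0 G (u j) ≡ g)
  vertex-kind j 1≤j j≤K+1 with j ≟ 1 | j ≤? K
  ... | yes refl | _       = inj₂ (inj₁ refl , refl)
  ... | no  j≢1  | yes j≤K = inj₁ (inner j (≤∧≢⇒< 1≤j (j≢1 ∘ sym)) j≤K)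
  ... | no  _    | no  j≰K = inj₂ (inj₂ j≡K+1 , trans (cong (degG0 G ∘ u) j≡K+1) (sym ends))
    where
    j≡K+1 : j ≡ suc K
    j≡K+1 = ≤-antisym j≤K+1 (≰⇒> j≰K)

  corner : ∀ j → 1 ≤ j → j ≤ suc K → Corner g (degG0 G (u j))
  corner j 1≤j j≤K+1 with vertex-kind j 1≤j j≤K+1
  ... | inj₁ d₀≡2      = inj₁ d₀≡2
  ... | inj₂ (_ , d₀≡g) = inj₂ d₀≡g

  end-position : ∀ j → 1 ≤ j → j ≤ suc K → degG0 G (u j) ≡ g → j ≡ 1 ⊎ j ≡ suc K
  end-position j 1≤j j≤K+1 d₀≡g with vertex-kind j 1≤j j≤K+1
  ... | inj₁ d₀≡2        = ⊥-elim (branching≢2 branching (trans (sym d₀≡g) d₀≡2))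
  ... | inj₂ (position , _) = position

  ends-of-jump : ∀ m → 1 ≤ m → 2 + m ≤ K → degG0 G (u m) ≡ g → degG0 G (u (3 + m)) ≡ g →
                 (m ≡ 1) × (K ≡ 3)
  ends-of-jump m 1≤m m+2≤K d₀≡g d₀'≡g
    with end-position m 1≤m (≤-trans (m≤n+m m 3) (s≤s m+2≤K)) d₀≡g
       | end-position (3 + m) (s≤s z≤n) (s≤s m+2≤K) d₀'≡g
  ... | inj₂ m≡K+1 | _           = ⊥-elim (<⇒≢ (s≤s (≤-trans (m≤n+m m 2) m+2≤K)) m≡K+1)
  ... | inj₁ refl  | inj₂ 4≡K+1  = refl , suc-injective (sym 4≡K+1)

  PartI : Set
  PartI = (K ≡ 3) × (b ≡ 1)
        × (g ≡ 3 → (a ≡ 6) × (deg G (u 1) ≡ 3)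
                  × ((deg G (u 2) ≡ 2 × deg G (u 3) ≡ 4) ⊎ (deg G (u 2) ≡ 4 × deg G (u 3) ≡ 2)))
        × (g ≡ 4 → (a ≡ 7) × (deg G (u 1) ≡ 4)
                  × ((deg G (u 2) ≡ 2 × deg G (u 3) ≡ 5) ⊎ (deg G (u 2) ≡ 5 × deg G (u 3) ≡ 2)))

  jump-at : ∀ m → 1 ≤ m → 2 + m ≤ K → deg G (u (suc m)) ≢ deg G (u (2 + m)) → PartI
  jump-at m 1≤m m+2≤K differ
    with jump branching (profile (u 1))
              (corner m 1≤m (≤-trans (m≤n+m m 2) (≤-trans m+2≤K (n≤1+n K))))
              (corner (3 + m) (s≤s z≤n) (s≤s m+2≤K))
              (interior-of-R m 1≤m (≤-trans (n≤1+n (suc m)) m+2≤K))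
              (interior-of-R (suc m) (s≤s z≤n) m+2≤K)
              differ (admissible m) (admissible (3 + m))
  ... | _ , J , middle , gy≡g , gz≡g , y≡g with ends-of-jump m 1≤m m+2≤K gy≡g gz≡g
  ...   | refl , K≡3 = K≡3 , jump-conclusion J middle y≡g

  part-i : (∃ λ i → 2 ≤ i × i ≤ K ∸ 1 × deg G (u i) ≢ deg G (u (suc i))) → PartI
  part-i (suc m , s≤s 1≤m , m+1≤K-1 , differ) = jump-at m 1≤m (≤-pred-∸ m+1≤K-1 1≤K) differ

  cycle-closing : IsCycleG0 G (suc K) u → adj G (u 1) (u K) ≡ true
  cycle-closing (_ , closed , _) = subst (λ w → adj G w (u K) ≡ true) (sym closed) (backward K 1≤K ≤-refl)

  cycle-ends-distinct : IsCycleG0 G (suc K) u → u 2 ≢ u K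
  cycle-ends-distinct cycle = cycle-distinct G cycle 2 K (s≤s z≤n) (≤-trans (n≤1+n 2) 3≤K) 1≤K ≤-refl (<⇒≢ 3≤K)

  module Constant (d : ℕ) (constant : ∀ i → 2 ≤ i → i ≤ K → deg G (u i) ≡ d) where

    at-u₂ : Interior a b (deg G (u 1) + d) d
    at-u₂ = subst₂ (λ y x → Interior a b (deg G (u 1) + y) x)
              (constant 3 (s≤s (s≤s z≤n)) 3≤K) (constant 2 ≤-refl 2≤K) (interior-of-R 1 ≤-refl 2≤K)

    degree-choice : d ≡ 2 ⊎ d + b + 1 ≡ a
    degree-choice with interior-admissible at-u₂
    ... | inj₁ d≡2  = inj₁ d≡2
    ... | inj₂ leaf = inj₂ (trans (reorder d b) leaf)
      where reorder : ∀ d b → d + b + 1 ≡ 1 + b + d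
            reorder = solve-∀

    -- If d = 2 and R is longer than 3, then the equations at u₂ and u₃
    -- (neighbour sums d(u₁) + 2 and 2 + 2) force d(u₁) = 2.
    long-of-degree-2 : 4 ≤ K → d ≡ 2 → ⊥
    long-of-degree-2 4≤K refl =
      end-degree branching (profile (u 1)) (+-cancelʳ-≡ 2 (deg G (u 1)) 2 (interior-sum-determined at-u₂ at-u₃))
      where
      at-u₃ : Interior a b (2 + 2) 2
      at-u₃ = subst₂ (λ y x → Interior a b (y + 2) x) (constant 2 ≤-refl 2≤K) (constant 3 (s≤s (s≤s z≤n)) 3≤K)
                (subst (λ z → Interior a b (deg G (u 2) + z) (deg G (u 3))) (constant 4 (s≤s (s≤s z≤n)) 4≤K)
                  (interior-of-R 2 (s≤s z≤n) 3≤K))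

    -- On a cycle the end u₁ = u_{K+1} has the two G₀-neighbours u₂ ≠ u_K,
    -- both of degree d; its profile then contradicts the equation at u₂.
    pendants-on-cycle : IsCycleG0 G (suc K) u → d ≢ 2 → ⊥
    pendants-on-cycle cycle d≢2
      with two-core-neighbours (cycle-ends-distinct cycle) (forward 1 ≤-refl 1≤K) (cycle-closing cycle)
             (in-G₀ 2 (s≤s z≤n) (≤-trans 2≤K (n≤1+n K))) (in-G₀ K 1≤K (n≤1+n K))
    ... | r , d₀≡2+r , bound , _ =
      no-pendant-cycle (subst Branching d₀≡2+r branching) at-u₂ d≢2
        (subst₂ (λ h σ → Profile a b h σ (deg G (u 1))) d₀≡2+r
                (cong₂ (λ y z → y + z + (r + r)) (constant 2 ≤-refl 2≤K) (constant K 2≤K ≤-refl))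
                (vertex-profile (u 1) bound))

    cycle-case : IsCycleG0 G (suc K) u → (K ≡ 3) × (deg G (u 2) ≡ 2) × (deg G (u 3) ≡ 2)
    cycle-case cycle with d ≟ 2
    ... | no  d≢2 = ⊥-elim (pendants-on-cycle cycle d≢2)
    ... | yes d≡2 with m≤n⇒m<n∨m≡n 3≤K
    ...   | inj₁ 4≤K = ⊥-elim (long-of-degree-2 4≤K d≡2)
    ...   | inj₂ 3≡K = sym 3≡K , trans (constant 2 ≤-refl 2≤K) d≡2 , trans (constant 3 (s≤s (s≤s z≤n)) 3≤K) d≡2

  part-ii : ∀ d → (∀ i → 2 ≤ i → i ≤ K → deg G (u i) ≡ d) →
            (d ≡ 2 ⊎ d + b + 1 ≡ a) × (IsCycleG0 G (suc K) u → (K ≡ 3) × (deg G (u 2) ≡ 2) × (deg G (u 3) ≡ 2))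
  part-ii d constant = degree-choice , cycle-case
    where open Constant d constant

lemma6 : ∀ {n} (G : Graph n) (a b : ℕ) → InClass G a b →
    ∀ (k : ℕ) (u : ℕ → Fin n) →
    (IsPathG0 G k u ⊎ IsCycleG0 G k u) →
    3 ≤ k ∸ 1 →
    degG0 G (u 1) ≡ degG0 G (u k) →
    (degG0 G (u 1) ≡ 3 ⊎ degG0 G (u 1) ≡ 4) →
    (∀ i → 2 ≤ i → i ≤ k ∸ 1 → degG0 G (u i) ≡ 2) →
    -- (i)
    ((∃ λ i → 2 ≤ i × i ≤ k ∸ 2 × deg G (u i) ≢ deg G (u (suc i))) →
      (k ∸ 1 ≡ 3) × (b ≡ 1)
      × (degG0 G (u 1) ≡ 3 →
          (a ≡ 6) × (deg G (u 1) ≡ 3)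
          × ((deg G (u 2) ≡ 2 × deg G (u 3) ≡ 4) ⊎ (deg G (u 2) ≡ 4 × deg G (u 3) ≡ 2)))
      × (degG0 G (u 1) ≡ 4 →
          (a ≡ 7) × (deg G (u 1) ≡ 4)
          × ((deg G (u 2) ≡ 2 × deg G (u 3) ≡ 5) ⊎ (deg G (u 2) ≡ 5 × deg G (u 3) ≡ 2))))
    ×
    -- (ii)
    (∀ (d : ℕ) → (∀ i → 2 ≤ i → i ≤ k ∸ 1 → deg G (u i) ≡ d) →
      (d ≡ 2 ⊎ d + b + 1 ≡ a)
      × (IsCycleG0 G k u → (k ∸ 1 ≡ 3) × (deg G (u 2) ≡ 2) × (deg G (u 3) ≡ 2)))
lemma6 _ _ _ _ zero _ _ () _ _ _
lemma6 G a b (_ , ((_ , _ , parabolic) , _) , (min-deg , _)) (suc K) u R 3≤K ends branching inner =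
  part-i , part-ii
  where open AlongR G a b min-deg parabolic K u R 3≤K ends branching inner
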